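{- Let $cc_3(n)$ denote the number of partitions $\lambda$ of $n$ that are $3$-cores and whose hookset is an initial segment of the positive integers not divisible by $3$, i.e. $Hk(\lambda)=\{h\in\{1,\dots,H\}: 3\nmid h\}$ where $H$ is the largest element of $Hk(\lambda)$ (the empty partition of $0$ counts). Then $$\sum_{n\ge0} cc_3(n)\,q^n = 1+q+2\sum_{k\ge2}\left(q^{k^2}+q^{k^2-k}\right).$$
   Context: For a partition $\lambda=(\lambda_1\ge\dots\ge\lambda_\ell\ge1)$, the hook length of cell $(i,j)$ ($1\le i\le\ell$, $1\le j\le\lambda_i$) is $h_{ij}=\lambda_i-j+\lambda'_j-i+1$ with $\lambda'_j=|\{a:\lambda_a\ge j\}|$, and $Hk(\lambda)$ is the set of all hook lengths. $\lambda$ is a $3$-core if no hook length is a multiple of $3$. -}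

module Defs where

open import Data.Nat using (ℕ; zero; suc; _+_; _*_; _∸_; _≤_; _<_; _≥_; _≡ᵇ_; _≤ᵇ_)
open import Data.Nat.Divisibility using (_∣_)
open import Data.Bool using (Bool; true; false; if_then_else_)
open import Data.Fin using (Fin; toℕ)
open import Data.List using (List; []; _∷_; length; lookup; filter; map; upTo)
open import Data.Nat.ListAction using (sum)
open import Data.List.Relation.Unary.All using (All)
open import Data.List.Relation.Unary.Linked using (Linked)
open import Data.Product using (Σ; _×_; ∃)
open import Data.Sum using (_⊎_)
open import Function.Bundles using (_⇔_)
open import Relation.Nullary using (¬_)
open import Relation.Binary.PropositionalEquality using (_≡_)

IsPartitionOf : ℕ → List ℕ → Set
IsPartitionOf n λs = Linked _≥_ λs × All (1 ≤_) λs × sum λs ≡ n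

conj : List ℕ → ℕ → ℕ
conj λs j = length (filter (j Data.Nat.≤?_) λs)

-- h is a hook length of λ: cell (i,j) with i 1-indexed row (i = suc (toℕ r)),
-- 1 ≤ j ≤ λ_i, h = λ_i - j + λ'_j - i + 1.
IsHook : List ℕ → ℕ → Set
IsHook λs h = Σ (Fin (length λs)) λ r → Σ ℕ λ j →
  1 ≤ j × j ≤ lookup λs r ×
  h ≡ (lookup λs r ∸ j) + (conj λs j ∸ suc (toℕ r)) + 1

Is3Core : List ℕ → Set
Is3Core λs = ∀ h → IsHook λs h → ¬ (3 ∣ h)

IsMaxHook : List ℕ → ℕ → Set
IsMaxHook λs H = IsHook λs H × (∀ h → IsHook λs h → h ≤ H)

HasInitialHookset : List ℕ → Set
HasInitialHookset λs = λs ≡ [] ⊎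
  Σ ℕ λ H → IsMaxHook λs H × (∀ h → IsHook λs h ⇔ (1 ≤ h × h ≤ H × ¬ (3 ∣ h)))

IsCC3 : List ℕ → Set
IsCC3 λs = Is3Core λs × HasInitialHookset λs

δ : Bool → ℕ
δ b = if b then 1 else 0

-- coefficient of q^n in 1 + q + 2 Σ_{k≥2} (q^{k²} + q^{k²-k}).
-- Terms with k > n contribute nothing to q^n (k² - k ≥ k for k ≥ 2), so k ranges over 2..n.
rhsCoeff : ℕ → ℕ
rhsCoeff n = δ (n ≡ᵇ 0) + δ (n ≡ᵇ 1) +
  2 * sum (map (λ k → if 2 ≤ᵇ k then δ (k * k ≡ᵇ n) + δ (k * k ∸ k ≡ᵇ n) else 0) (upTo (suc n)))

module Submission where

-- Write nonMult u for the (u+1)-st positive integer not divisible by 3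
-- (1, 2, 4, 5, 7, …).  Two families of partitions have as hookset exactly
-- the first m such numbers: the 2-staircase  stair m = (m, m-2, m-4, …)  and
-- its conjugate  costair m = (⌈m/2⌉, ⌈(m-1)/2⌉, …, ⌈1/2⌉).  Both have size
-- size m = |stair m|, which is t² for m = 2t-1 and t² - t for m = 2t.
--
-- Conversely, building a 3-core row by row from the bottom and looking at the
-- gap between the new first row and the one below it (most gaps create a hook
-- of length 3) shows that every 3-core is a stair, a costair, or a "hybrid"
-- (y+2, y, …) ending in two rows of length 1.  In a hybrid the corner hook
-- exceeds every other hook by at least 3, so its hookset has a gap.
--
-- Hence cc₃(n) counts the stairs and costairs of size n, which coincide only
-- for m ≤ 1.  As size is strictly increasing, cc₃(n) is 1 for n ∈ {0, 1}, 2 for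
-- n ∈ {t², t² - t} with t ≥ 2 and 0 otherwise: the coefficient of qⁿ.

open import Defs
open import Data.Nat using (ℕ; zero; suc; _+_; _*_; _∸_; _≤_; _<_; _≥_; z≤n; s≤s; _≡ᵇ_; _≤ᵇ_; _≤?_; _≟_; ⌊_/2⌋; ⌈_/2⌉)
open import Data.Nat.Properties
open import Data.Nat.Divisibility using (_∣_; ∣-refl; ∣⇒≤; ∣m∣n⇒∣m+n; ∣m+n∣m⇒∣n; _∣?_)
open import Data.Nat.ListAction using (sum)
open import Data.Nat.Tactic.RingSolver using (solve-∀)
open import Data.Bool using (if_then_else_)
open import Data.Fin using (Fin; toℕ; fromℕ<) renaming (zero to fzero; suc to fsuc)
open import Data.Fin.Properties using (any?; toℕ-fromℕ<)
open import Data.List using (List; []; _∷_; length; lookup; filter; applyUpTo; _++_)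
open import Data.List.Properties using (filter-accept; filter-reject; length-filter; filter-++; length-++; map-upTo; ∷-injectiveˡ)
open import Data.List.Relation.Unary.All using (All; []; _∷_)
open import Data.List.Relation.Unary.Linked using (Linked; []; [-]; _∷_; head; tail)
open import Data.List.Membership.Propositional using (_∈_)
open import Data.List.Relation.Unary.Any using (here; there)
open import Data.List.Relation.Unary.Unique.Propositional using (Unique)
open import Data.List.Relation.Unary.AllPairs using ([]; _∷_)
open import Data.Product using (Σ; _×_; _,_; proj₁; proj₂)
open import Data.Sum using (_⊎_; inj₁; inj₂; [_,_]′)
open import Data.Empty using (⊥; ⊥-elim)
open import Function.Base using (_∘_)
open import Function.Bundles using (_⇔_; mk⇔; Equivalence)
open import Function.Properties.Equivalence using () renaming (trans to ⇔-trans; sym to ⇔-sym)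
open import Relation.Nullary using (¬_; yes; no)
open import Relation.Binary.PropositionalEquality using (_≡_; _≢_; refl; sym; trans; cong; cong₂; subst; module ≡-Reasoning)

open Equivalence using (to; from)

pattern 2+ n = suc (suc n)

conj-cons-≤ : ∀ {x j} xs → j ≤ x → conj (x ∷ xs) j ≡ suc (conj xs j)
conj-cons-≤ {x} {j} xs j≤x = cong length (filter-accept (j ≤?_) {x} {xs} j≤x)

conj-cons-> : ∀ {x j} xs → x < j → conj (x ∷ xs) j ≡ conj xs j
conj-cons-> {x} {j} xs x<j = cong length (filter-reject (j ≤?_) {x} {xs} (<⇒≱ x<j))

conj-beyond : ∀ {x j} xs → Linked _≥_ (x ∷ xs) → x < j → conj (x ∷ xs) j ≡ 0
conj-beyond []       [-]         x<j = conj-cons-> [] x<j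
conj-beyond (y ∷ ys) (y≤x ∷ ord) x<j =
  trans (conj-cons-> (y ∷ ys) x<j) (conj-beyond ys ord (≤-<-trans y≤x x<j))

conj-≤-length : ∀ xs j → conj xs j ≤ length xs
conj-≤-length xs j = length-filter (j ≤?_) xs

conj-++ : ∀ xs ys j → conj (xs ++ ys) j ≡ conj xs j + conj ys j
conj-++ xs ys j = trans (cong length (filter-++ (j ≤?_) xs ys)) (length-++ (filter (j ≤?_) xs))

conj-one : ∀ xs → All (1 ≤_) xs → conj xs 1 ≡ length xs
conj-one []       []           = refl
conj-one (x ∷ xs) (1≤x ∷ pos) = trans (conj-cons-≤ xs 1≤x) (cong suc (conj-one xs pos))

lookup-≤-head : ∀ {x} xs → Linked _≥_ (x ∷ xs) → (r : Fin (length xs)) → lookup xs r ≤ x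
lookup-≤-head (y ∷ ys) (y≤x ∷ ord) fzero    = y≤x
lookup-≤-head (y ∷ ys) (y≤x ∷ ord) (fsuc r) = ≤-trans (lookup-≤-head ys ord r) y≤x

leg-cons : ∀ {x j} xs i → j ≤ x → conj (x ∷ xs) j ∸ suc i ≡ conj xs j ∸ i
leg-cons xs i j≤x = cong (_∸ suc i) (conj-cons-≤ xs j≤x)

FirstRowHook : ℕ → List ℕ → ℕ → Set
FirstRowHook x xs h = Σ ℕ λ j → 1 ≤ j × j ≤ x × h ≡ (x ∸ j) + conj xs j + 1

hook-split : ∀ {x xs h} → Linked _≥_ (x ∷ xs) → IsHook (x ∷ xs) h → FirstRowHook x xs h ⊎ IsHook xs h
hook-split {x} {xs} ord (fzero , j , 1≤j , j≤x , h≡) =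
  inj₁ (j , 1≤j , j≤x , trans h≡ (cong (λ c → (x ∸ j) + c + 1) (leg-cons xs 0 j≤x)))
hook-split {x} {xs} ord (fsuc r , j , 1≤j , j≤λr , h≡) =
  inj₂ (r , j , 1≤j , j≤λr , trans h≡ (cong (λ c → (lookup xs r ∸ j) + c + 1)
    (leg-cons xs (suc (toℕ r)) (≤-trans j≤λr (lookup-≤-head xs ord r)))))

hook-join : ∀ {x xs h} → Linked _≥_ (x ∷ xs) → FirstRowHook x xs h ⊎ IsHook xs h → IsHook (x ∷ xs) h
hook-join {x} {xs} ord (inj₁ (j , 1≤j , j≤x , h≡)) =
  fzero , j , 1≤j , j≤x , trans h≡ (cong (λ c → (x ∸ j) + c + 1) (sym (leg-cons xs 0 j≤x)))
hook-join {x} {xs} ord (inj₂ (r , j , 1≤j , j≤λr , h≡)) =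
  fsuc r , j , 1≤j , j≤λr , trans h≡ (cong (λ c → (lookup xs r ∸ j) + c + 1)
    (sym (leg-cons xs (suc (toℕ r)) (≤-trans j≤λr (lookup-≤-head xs ord r)))))

core-tail : ∀ {x xs} → Linked _≥_ (x ∷ xs) → Is3Core (x ∷ xs) → Is3Core xs
core-tail ord core h hk = core h (hook-join ord (inj₂ hk))

no-hook-3 : ∀ {x xs} → Linked _≥_ (x ∷ xs) → Is3Core (x ∷ xs) →
  ∀ j → 1 ≤ j → j ≤ x → (x ∸ j) + conj xs j + 1 ≡ 3 → ⊥
no-hook-3 ord core j 1≤j j≤x h≡3 = core 3 (hook-join ord (inj₁ (j , 1≤j , j≤x , sym h≡3))) ∣-refl

hook-≤ : ∀ {t} rs h → Linked _≥_ (t ∷ rs) → IsHook (t ∷ rs) h → h ≤ t + length rs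
hook-≤ {t} rs h ord (r , j , 1≤j , j≤λr , h≡) = begin
  h                                    ≡⟨ trans h≡ (+-assoc arm leg 1) ⟩
  arm + (leg + 1)                      ≡⟨ cong (arm +_) (+-comm leg 1) ⟩
  arm + (1 + leg)                      ≡⟨ +-assoc arm 1 leg ⟨
  arm + 1 + leg                        ≤⟨ +-mono-≤ arm+1≤t leg≤ ⟩
  t + length rs                        ∎
  where
  open ≤-Reasoning
  row≤t : (r : Fin (suc (length rs))) → lookup (t ∷ rs) r ≤ t
  row≤t fzero    = ≤-refl
  row≤t (fsuc r) = lookup-≤-head rs ord r
  arm leg : ℕ
  arm = lookup (t ∷ rs) r ∸ j
  leg = conj (t ∷ rs) j ∸ suc (toℕ r)
  arm+1≤t : arm + 1 ≤ t
  arm+1≤t = ≤-trans (+-monoʳ-≤ arm 1≤j) (≤-trans (≤-reflexive (m∸n+n≡m j≤λr)) (row≤t r))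
  leg≤ : leg ≤ length rs
  leg≤ = ∸-mono (conj-≤-length (t ∷ rs) j) (s≤s z≤n)

Increasing : (ℕ → ℕ) → Set
Increasing f = ∀ m → f m < f (suc m)

module _ {f : ℕ → ℕ} (f-inc : Increasing f) where

  inc-< : ∀ {u v} → u < v → f u < f v
  inc-< {u} {suc v} (s≤s u≤v) with m≤n⇒m<n∨m≡n u≤v
  ... | inj₁ u<v  = <-trans (inc-< u<v) (f-inc v)
  ... | inj₂ refl = f-inc u

  inc-≤ : ∀ {u v} → u ≤ v → f u ≤ f v
  inc-≤ u≤v with m≤n⇒m<n∨m≡n u≤v
  ... | inj₁ u<v  = <⇒≤ (inc-< u<v)
  ... | inj₂ refl = ≤-refl

  inc-reflects-≤ : ∀ {u v} → f u ≤ f v → u ≤ v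
  inc-reflects-≤ {u} {v} fu≤fv with u ≤? v
  ... | yes u≤v = u≤v
  ... | no  u≰v = ⊥-elim (<⇒≱ (inc-< (≰⇒> u≰v)) fu≤fv)

  inc-injective : ∀ {u v} → f u ≡ f v → u ≡ v
  inc-injective fu≡fv =
    ≤-antisym (inc-reflects-≤ (≤-reflexive fu≡fv)) (inc-reflects-≤ (≤-reflexive (sym fu≡fv)))

  inc-≥-id : ∀ m → m ≤ f m
  inc-≥-id zero    = z≤n
  inc-≥-id (suc m) = ≤-trans (s≤s (inc-≥-id m)) (f-inc m)

  -- Membership in the image is decidable, since a preimage of n is at most n.
  inc-preimage? : ∀ n → (Σ ℕ λ m → f m ≡ n) ⊎ (∀ m → f m ≢ n)
  inc-preimage? n with any? {n = suc n} (λ i → f (toℕ i) ≟ n)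
  ... | yes (i , fi≡n) = inj₁ (toℕ i , fi≡n)
  ... | no  none       = inj₂ λ m fm≡n →
    none (fromℕ< (s≤s (subst (m ≤_) fm≡n (inc-≥-id m))) ,
          subst (λ k → f k ≡ n) (sym (toℕ-fromℕ< _)) fm≡n)

nonMult : ℕ → ℕ
nonMult 0      = 1
nonMult 1      = 2
nonMult (2+ u) = 3 + nonMult u

¬3∣1 : ¬ 3 ∣ 1
¬3∣1 3∣1 with ∣⇒≤ 3∣1
... | s≤s ()

¬3∣2 : ¬ 3 ∣ 2
¬3∣2 3∣2 with ∣⇒≤ 3∣2
... | s≤s (s≤s ())

¬3∣-one-of : ∀ k → ¬ 3 ∣ k ⊎ ¬ 3 ∣ suc k
¬3∣-one-of k with 3 ∣? k
... | no  ¬3∣k = inj₁ ¬3∣k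
... | yes 3∣k  = inj₂ λ 3∣k+1 → ¬3∣1 (∣m+n∣m⇒∣n (subst (3 ∣_) (+-comm 1 k) 3∣k+1) 3∣k)

nonMult-¬3∣ : ∀ u → ¬ 3 ∣ nonMult u
nonMult-¬3∣ 0      = ¬3∣1
nonMult-¬3∣ 1      = ¬3∣2
nonMult-¬3∣ (2+ u) 3∣ = nonMult-¬3∣ u (∣m+n∣m⇒∣n 3∣ ∣-refl)

nonMult-increasing : Increasing nonMult
nonMult-increasing 0      = s≤s (s≤s z≤n)
nonMult-increasing 1      = s≤s (s≤s (s≤s z≤n))
nonMult-increasing (2+ u) = +-monoʳ-< 3 (nonMult-increasing u)

nonMult-positive : ∀ u → 1 ≤ nonMult u
nonMult-positive u = inc-≤ nonMult-increasing (z≤n {u})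

nonMult-onto : ∀ h → 1 ≤ h → ¬ 3 ∣ h → Σ ℕ λ u → h ≡ nonMult u
nonMult-onto 1 _ _ = 0 , refl
nonMult-onto 2 _ _ = 1 , refl
nonMult-onto 3 _ ¬3∣3 = ⊥-elim (¬3∣3 ∣-refl)
nonMult-onto (suc (2+ (suc h))) _ ¬3∣h+3 with nonMult-onto (suc h) (s≤s z≤n) (¬3∣h+3 ∘ ∣m∣n⇒∣m+n ∣-refl)
... | u , h≡ = 2+ u , cong (3 +_) h≡

nonMult-closed : ∀ u → u + ⌊ u /2⌋ + 1 ≡ nonMult u
nonMult-closed 0      = refl
nonMult-closed 1      = refl
nonMult-closed (2+ u) = cong (2 +_) (trans (cong (_+ 1) (+-suc u ⌊ u /2⌋)) (cong suc (nonMult-closed u)))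

FirstNonMults : ℕ → ℕ → Set
FirstNonMults m h = Σ ℕ λ u → u < m × h ≡ nonMult u

firstNonMults⇔ : ∀ m h → FirstNonMults (suc m) h ⇔ (1 ≤ h × h ≤ nonMult m × ¬ 3 ∣ h)
firstNonMults⇔ m h = mk⇔ forward backward
  where
  forward : FirstNonMults (suc m) h → 1 ≤ h × h ≤ nonMult m × ¬ 3 ∣ h
  forward (u , s≤s u≤m , h≡) = subst (λ k → 1 ≤ k × k ≤ nonMult m × ¬ 3 ∣ k) (sym h≡)
    (nonMult-positive u , inc-≤ nonMult-increasing u≤m , nonMult-¬3∣ u)
  backward : 1 ≤ h × h ≤ nonMult m × ¬ 3 ∣ h → FirstNonMults (suc m) h
  backward (1≤h , h≤ , ¬3∣h) with nonMult-onto h 1≤h ¬3∣h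
  ... | u , h≡ = u , s≤s (inc-reflects-≤ nonMult-increasing (subst (_≤ nonMult m) h≡ h≤)) , h≡

initial⇒3core : ∀ {μ m} → (∀ h → IsHook μ h ⇔ FirstNonMults m h) → Is3Core μ
initial⇒3core hooks h hk with to (hooks h) hk
... | u , _ , h≡ = subst (λ k → ¬ 3 ∣ k) (sym h≡) (nonMult-¬3∣ u)

initial⇒CC3 : ∀ μ m → (∀ h → IsHook μ h ⇔ FirstNonMults m h) → (m ≡ 0 → μ ≡ []) → IsCC3 μ
initial⇒CC3 μ zero    hooks empty = initial⇒3core {μ} hooks , inj₁ (empty refl)
initial⇒CC3 μ (suc m) hooks _     =
  initial⇒3core {μ} hooks , inj₂ (nonMult m , (from (hooks _) (m , ≤-refl , refl) , max) , segment)
  where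
  segment : ∀ h → IsHook μ h ⇔ (1 ≤ h × h ≤ nonMult m × ¬ 3 ∣ h)
  segment h = ⇔-trans (hooks h) (firstNonMults⇔ m h)
  max : ∀ h → IsHook μ h → h ≤ nonMult m
  max h hk = proj₁ (proj₂ (to (segment h) hk))

stair : ℕ → List ℕ
stair 0      = []
stair 1      = 1 ∷ []
stair (2+ m) = 2+ m ∷ stair m

stair-decreasing : ∀ m → Linked _≥_ (stair m)
stair-decreasing 0          = []
stair-decreasing 1          = [-]
stair-decreasing 2          = [-]
stair-decreasing 3          = s≤s z≤n ∷ [-]
stair-decreasing (2+ (2+ m)) = m≤n+m (2+ m) 2 ∷ stair-decreasing (2+ m)

stair-positive : ∀ m → All (1 ≤_) (stair m)
stair-positive 0      = []
stair-positive 1      = s≤s z≤n ∷ []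
stair-positive (2+ m) = s≤s z≤n ∷ stair-positive m

⌊≤1/2⌋ : ∀ k → k ≤ 1 → ⌊ k /2⌋ ≡ 0
⌊≤1/2⌋ 0 _ = refl
⌊≤1/2⌋ 1 _ = refl
⌊≤1/2⌋ (2+ k) (s≤s ())

conj-stair : ∀ m j → 1 ≤ j → conj (stair m) j ≡ ⌊ 2+ m ∸ j /2⌋
conj-stair 0 (suc j) _ = sym (⌊≤1/2⌋ (1 ∸ j) (m∸n≤m 1 j))
conj-stair 1 1 _ = refl
conj-stair 1 (2+ j) _ = sym (⌊≤1/2⌋ (1 ∸ j) (m∸n≤m 1 j))
conj-stair (2+ m) j 1≤j with j ≤? 2+ m
... | yes j≤ = begin
  conj (stair (2+ m)) j    ≡⟨ conj-cons-≤ (stair m) j≤ ⟩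
  suc (conj (stair m) j)   ≡⟨ cong suc (conj-stair m j 1≤j) ⟩
  ⌊ 2 + (2+ m ∸ j) /2⌋     ≡⟨ cong ⌊_/2⌋ (+-∸-assoc 2 j≤) ⟨
  ⌊ 2+ (2+ m) ∸ j /2⌋      ∎
  where open ≡-Reasoning
... | no j≰ = trans (conj-beyond (stair m) (stair-decreasing (2+ m)) (≰⇒> j≰))
                    (sym (⌊≤1/2⌋ _ (≤-trans (∸-monoʳ-≤ (2+ (2+ m)) (≰⇒> j≰)) (≤-reflexive (m+n∸n≡m 1 (suc (2+ m)))))))

-- The first row of stair (m+2) carries the hooks nonMult u, u < m+2: cell j
-- has arm u = m+2-j and leg ⌊u/2⌋.
stair-row : ∀ m h → FirstRowHook (2+ m) (stair m) h ⇔ FirstNonMults (2+ m) h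
stair-row m h = mk⇔ forward backward
  where
  forward : FirstRowHook (2+ m) (stair m) h → FirstNonMults (2+ m) h
  forward (suc j , 1≤j , _ , h≡) = 2+ m ∸ suc j , s≤s (m∸n≤m (suc m) j) , (begin
    h                                              ≡⟨ h≡ ⟩
    (2+ m ∸ suc j) + conj (stair m) (suc j) + 1    ≡⟨ cong (λ c → (2+ m ∸ suc j) + c + 1) (conj-stair m (suc j) 1≤j) ⟩
    (2+ m ∸ suc j) + ⌊ 2+ m ∸ suc j /2⌋ + 1        ≡⟨ nonMult-closed (2+ m ∸ suc j) ⟩
    nonMult (2+ m ∸ suc j)                         ∎)
    where open ≡-Reasoning
  backward : FirstNonMults (2+ m) h → FirstRowHook (2+ m) (stair m) h
  backward (u , u<m+2 , h≡) = 2+ m ∸ u , 1≤j , m∸n≤m (2+ m) u , (begin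
    h                                                  ≡⟨ trans h≡ (sym (nonMult-closed u)) ⟩
    u + ⌊ u /2⌋ + 1                                    ≡⟨ cong (λ k → k + ⌊ k /2⌋ + 1) (m∸[m∸n]≡n (<⇒≤ u<m+2)) ⟨
    (2+ m ∸ j) + ⌊ 2+ m ∸ j /2⌋ + 1                    ≡⟨ cong (λ c → (2+ m ∸ j) + c + 1) (conj-stair m j 1≤j) ⟨
    (2+ m ∸ j) + conj (stair m) j + 1                  ∎)
    where
    open ≡-Reasoning
    j : ℕ
    j = 2+ m ∸ u
    1≤j : 1 ≤ j
    1≤j = subst (1 ≤_) (sym (+-∸-assoc 1 (≤-pred u<m+2))) (s≤s z≤n)

stair-hooks : ∀ m h → IsHook (stair m) h ⇔ FirstNonMults m h
stair-hooks m h = mk⇔ (forward m) (backward m)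
  where
  forward : ∀ m {h} → IsHook (stair m) h → FirstNonMults m h
  forward 0 (() , _)
  forward 1 (fzero , suc j , _ , s≤s z≤n , h≡) = 0 , s≤s z≤n , h≡
  forward (2+ m) hk with hook-split (stair-decreasing (2+ m)) hk
  ... | inj₁ row = to (stair-row m _) row
  ... | inj₂ hk′ with forward m hk′
  ...   | u , u<m , h≡ = u , ≤-trans u<m (m≤n+m m 2) , h≡
  backward : ∀ m {h} → FirstNonMults m h → IsHook (stair m) h
  backward 0 (_ , () , _)
  backward 1 (0 , _ , h≡) = fzero , 1 , s≤s z≤n , s≤s z≤n , h≡
  backward 1 (suc _ , s≤s () , _)
  backward (2+ m) nm = hook-join (stair-decreasing (2+ m)) (inj₁ (from (stair-row m _) nm))

-- costair m = (⌈m/2⌉, ⌈(m-1)/2⌉, …, ⌈1/2⌉), the conjugate of stair m.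
costair : ℕ → List ℕ
costair 0       = []
costair (suc m) = ⌈ suc m /2⌉ ∷ costair m

costair-decreasing : ∀ m → Linked _≥_ (costair m)
costair-decreasing 0      = []
costair-decreasing 1      = [-]
costair-decreasing (2+ m) = ⌈n/2⌉-mono (n≤1+n (suc m)) ∷ costair-decreasing (suc m)

costair-positive : ∀ m → All (1 ≤_) (costair m)
costair-positive 0       = []
costair-positive (suc m) = s≤s z≤n ∷ costair-positive m

-- double n = 2n, by recursion so that double (n+1) unfolds to 2 + double n.
double : ℕ → ℕ
double 0       = 0
double (suc n) = 2+ (double n)

double-mono : ∀ {a b} → a ≤ b → double a ≤ double b
double-mono z≤n       = z≤n
double-mono (s≤s a≤b) = s≤s (s≤s (double-mono a≤b))

≤-double-⌈/2⌉ : ∀ m → m ≤ double ⌈ m /2⌉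
≤-double-⌈/2⌉ 0      = z≤n
≤-double-⌈/2⌉ 1      = s≤s z≤n
≤-double-⌈/2⌉ (2+ m) = s≤s (s≤s (≤-double-⌈/2⌉ m))

double-⌈/2⌉-≤ : ∀ m → double ⌈ m /2⌉ ≤ suc m
double-⌈/2⌉-≤ 0      = z≤n
double-⌈/2⌉-≤ 1      = ≤-refl
double-⌈/2⌉-≤ (2+ m) = s≤s (s≤s (double-⌈/2⌉-≤ m))

⌈+double/2⌉ : ∀ n i → ⌈ n + double i /2⌉ ≡ ⌈ n /2⌉ + i
⌈+double/2⌉ n zero    = trans (cong ⌈_/2⌉ (+-identityʳ n)) (sym (+-identityʳ ⌈ n /2⌉))
⌈+double/2⌉ n (suc i) = begin
  ⌈ n + 2+ (double i) /2⌉   ≡⟨ cong ⌈_/2⌉ (trans (+-suc n _) (cong suc (+-suc n _))) ⟩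
  suc ⌈ n + double i /2⌉    ≡⟨ cong suc (⌈+double/2⌉ n i) ⟩
  suc (⌈ n /2⌉ + i)         ≡⟨ +-suc ⌈ n /2⌉ i ⟨
  ⌈ n /2⌉ + suc i           ∎
  where open ≡-Reasoning

conj-costair : ∀ m j → 1 ≤ j → conj (costair m) j ≡ 2+ m ∸ double j
conj-costair 0       (suc j) _ = sym (0∸n≡0 (double j))
conj-costair (suc m) j 1≤j with j ≤? ⌈ suc m /2⌉
... | yes j≤ = begin
  conj (costair (suc m)) j     ≡⟨ conj-cons-≤ (costair m) j≤ ⟩
  suc (conj (costair m) j)     ≡⟨ cong suc (conj-costair m j 1≤j) ⟩
  1 + (2+ m ∸ double j)        ≡⟨ +-∸-assoc 1 (≤-trans (double-mono j≤) (double-⌈/2⌉-≤ (suc m))) ⟨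
  2+ (suc m) ∸ double j        ∎
  where open ≡-Reasoning
... | no j≰ = trans (conj-beyond (costair m) (costair-decreasing (suc m)) (≰⇒> j≰))
                    (sym (m≤n⇒m∸n≡0 (≤-trans (s≤s (s≤s (≤-double-⌈/2⌉ (suc m)))) (double-mono (≰⇒> j≰)))))

costair-row : ∀ m {h} → FirstRowHook ⌈ suc m /2⌉ (costair m) h → FirstNonMults (suc m) h
costair-row m {h} (suc i , _ , i<⌈⌉ , h≡) = k , s≤s (m∸n≤m m (double i)) , (begin
  h                                                      ≡⟨ h≡ ⟩
  (⌈ suc m /2⌉ ∸ suc i) + conj (costair m) (suc i) + 1   ≡⟨ cong₂ (λ a l → a + l + 1) arm (conj-costair m (suc i) (s≤s z≤n)) ⟩
  ⌊ k /2⌋ + k + 1                                        ≡⟨ cong (_+ 1) (+-comm ⌊ k /2⌋ k) ⟩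
  k + ⌊ k /2⌋ + 1                                        ≡⟨ nonMult-closed k ⟩
  nonMult k                                              ∎)
  where
  open ≡-Reasoning
  2i≤m : double i ≤ m
  2i≤m = ≤-pred (≤-pred (≤-trans (double-mono i<⌈⌉) (double-⌈/2⌉-≤ (suc m))))
  k : ℕ
  k = m ∸ double i
  arm : ⌈ suc m /2⌉ ∸ suc i ≡ ⌊ k /2⌋
  arm = begin
    ⌈ suc m /2⌉ ∸ suc i              ≡⟨ cong (λ t → ⌈ suc t /2⌉ ∸ suc i) (m∸n+n≡m 2i≤m) ⟨
    ⌈ suc k + double i /2⌉ ∸ suc i   ≡⟨ cong (_∸ suc i) (⌈+double/2⌉ (suc k) i) ⟩
    suc ⌊ k /2⌋ + i ∸ suc i          ≡⟨ m+n∸n≡m ⌊ k /2⌋ i ⟩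
    ⌊ k /2⌋                          ∎

costair-corner : ∀ m → FirstRowHook ⌈ suc m /2⌉ (costair m) (nonMult m)
costair-corner m = 1 , s≤s z≤n , s≤s z≤n , (begin
  nonMult m                                    ≡⟨ nonMult-closed m ⟨
  m + ⌊ m /2⌋ + 1                              ≡⟨ cong (_+ 1) (+-comm m ⌊ m /2⌋) ⟩
  ⌊ m /2⌋ + m + 1                              ≡⟨ cong (λ l → ⌊ m /2⌋ + l + 1) (conj-costair m 1 (s≤s z≤n)) ⟨
  (⌈ suc m /2⌉ ∸ 1) + conj (costair m) 1 + 1   ∎)
  where open ≡-Reasoning

costair-hooks : ∀ m h → IsHook (costair m) h ⇔ FirstNonMults m h
costair-hooks m h = mk⇔ (forward m) (backward m)
  where
  forward : ∀ m {h} → IsHook (costair m) h → FirstNonMults m h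
  forward 0 (() , _)
  forward (suc m) hk with hook-split (costair-decreasing (suc m)) hk
  ... | inj₁ row = costair-row m row
  ... | inj₂ hk′ with forward m hk′
  ...   | u , u<m , h≡ = u , ≤-trans u<m (n≤1+n m) , h≡
  backward : ∀ m {h} → FirstNonMults m h → IsHook (costair m) h
  backward 0 (_ , () , _)
  backward (suc m) (u , s≤s u≤m , h≡) with m≤n⇒m<n∨m≡n u≤m
  ... | inj₁ u<m  = hook-join (costair-decreasing (suc m)) (inj₂ (backward m (u , u<m , h≡)))
  ... | inj₂ refl = hook-join (costair-decreasing (suc m))
                      (inj₁ (subst (FirstRowHook _ (costair m)) (sym h≡) (costair-corner m)))

size : ℕ → ℕ
size m = sum (stair m)

-- stair (m+1) arises from stair m by adding a column of ⌈(m+1)/2⌉ cells.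
size-suc : ∀ m → size (suc m) ≡ ⌈ suc m /2⌉ + size m
size-suc 0      = refl
size-suc 1      = refl
size-suc (2+ m) = trans (cong (3 + m +_) (size-suc m)) (regroup m ⌈ suc m /2⌉ (size m))
  where
  regroup : ∀ a b c → 3 + a + (b + c) ≡ suc b + (2 + a + c)
  regroup = solve-∀

sum-costair : ∀ m → sum (costair m) ≡ size m
sum-costair 0       = refl
sum-costair (suc m) = trans (cong (⌈ suc m /2⌉ +_) (sum-costair m)) (sym (size-suc m))

size-increasing : Increasing size
size-increasing m = subst (size m <_) (sym (size-suc m)) (s≤s (m≤n+m (size m) ⌊ m /2⌋))

double≡+ : ∀ t → double t ≡ t + t
double≡+ 0       = refl
double≡+ (suc t) = cong suc (trans (cong suc (double≡+ t)) (sym (+-suc t t)))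

size-odd : ∀ t → size (suc (double t)) ≡ suc t * suc t
size-odd 0       = refl
size-odd (suc t) = trans (cong₂ _+_ (cong (3 +_) (double≡+ t)) (size-odd t)) (square t)
  where
  square : ∀ t → 3 + (t + t) + suc t * suc t ≡ 2+ t * 2+ t
  square = solve-∀

size-even : ∀ t → size (double t) ≡ t * suc t
size-even 0       = refl
size-even (suc t) = trans (cong₂ _+_ (cong (2 +_) (double≡+ t)) (size-even t)) (oblong t)
  where
  oblong : ∀ t → 2 + (t + t) + t * suc t ≡ suc t * 2+ t
  oblong = solve-∀

stair-counted : ∀ m → IsPartitionOf (size m) (stair m) × IsCC3 (stair m)
stair-counted m = (stair-decreasing m , stair-positive m , refl) ,
                  initial⇒CC3 (stair m) m (stair-hooks m) (λ { refl → refl })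

costair-counted : ∀ m → IsPartitionOf (size m) (costair m) × IsCC3 (costair m)
costair-counted m = (costair-decreasing m , costair-positive m , sum-costair m) ,
                    initial⇒CC3 (costair m) m (costair-hooks m) (λ { refl → refl })

gap : ∀ {x y} → y ≤ x → Σ ℕ λ d → x ≡ d + y
gap {x} {y} y≤x = x ∸ y , sym (m∸n+n≡m y≤x)

-- The shapes of 3-cores.  Hybrids (y+2, y, …, 1, 1) arise by stacking rows
-- with step 2 on top of a costair.
data Shape3 : List ℕ → Set where
  stair-shape   : ∀ m → Shape3 (stair m)
  costair-shape : ∀ m → Shape3 (costair m)
  hybrid-shape  : ∀ {y rest} pre → y ∷ rest ≡ pre ++ 1 ∷ 1 ∷ [] → Shape3 (2+ y ∷ y ∷ rest)

-- A gap of at least 3 below the first row gives the cell two columns left of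
-- the row's end the hook 3.
wide-gap : ∀ {d y r} → Linked _≥_ (suc (2+ d) + y ∷ y ∷ r) → ¬ Is3Core (suc (2+ d) + y ∷ y ∷ r)
wide-gap {d} {y} {r} ord core = no-hook-3 ord core (suc (d + y)) (s≤s z≤n) (m≤n+m _ 2)
  (cong₂ (λ a l → a + l + 1) (m+n∸n≡m 2 (suc (d + y))) (conj-beyond r (tail ord) (s≤s (m≤n+m y d))))

extend-empty : ∀ x → 1 ≤ x → Is3Core (x ∷ []) → Shape3 (x ∷ [])
extend-empty 1 _ _ = stair-shape 1
extend-empty 2 _ _ = stair-shape 2
extend-empty (suc (2+ x)) _ core =
  ⊥-elim (no-hook-3 [-] core (suc x) (s≤s z≤n) (m≤n+m _ 2) (cong (λ a → a + 0 + 1) (m+n∸n≡m 2 (suc x))))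

-- A 3-core with stair m below its first row.  Gaps 0 and 1 (for m ≥ 2) put
-- hook 3 at the cell with arm 1 and leg 1.
extend-stair : ∀ x m → Linked _≥_ (x ∷ stair m) → 1 ≤ x → Is3Core (x ∷ stair m) → Shape3 (x ∷ stair m)
extend-stair x 0 _ 1≤x core = extend-empty x 1≤x core
extend-stair x 1 ord _ core with gap (head ord)
... | 0 , refl        = costair-shape 2
... | 1 , refl        = ⊥-elim (no-hook-3 ord core 1 (s≤s z≤n) (s≤s z≤n) refl)
... | 2 , refl        = stair-shape 3
... | suc (2+ d) , refl = ⊥-elim (wide-gap ord core)
extend-stair x (2+ m) ord _ core with gap (head ord)
... | 0 , refl = ⊥-elim (no-hook-3 ord core (suc m) (s≤s z≤n) (n≤1+n _)
      (cong₂ (λ a l → a + l + 1) (m+n∸n≡m 1 m)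
        (trans (conj-cons-≤ (stair m) (n≤1+n _))
               (cong suc (trans (conj-stair m (suc m) (s≤s z≤n)) (cong ⌊_/2⌋ (m+n∸n≡m 1 m)))))))
... | 1 , refl = ⊥-elim (no-hook-3 ord core (2+ m) (s≤s z≤n) (n≤1+n _)
      (cong₂ (λ a l → a + l + 1) (m+n∸n≡m 1 (suc m))
        (trans (conj-cons-≤ (stair m) ≤-refl)
               (cong suc (trans (conj-stair m (2+ m) (s≤s z≤n)) (cong ⌊_/2⌋ (n∸n≡0 m)))))))
... | 2 , refl = stair-shape (2+ (2+ m))
... | suc (2+ d) , refl = ⊥-elim (wide-gap ord core)

⌈suc/2⌉-step : ∀ m → ⌈ suc m /2⌉ ≡ suc ⌈ m /2⌉ ⊎ ⌈ suc m /2⌉ ≡ ⌈ m /2⌉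
⌈suc/2⌉-step 0      = inj₁ refl
⌈suc/2⌉-step 1      = inj₂ refl
⌈suc/2⌉-step (2+ m) with ⌈suc/2⌉-step m
... | inj₁ e = inj₁ (cong suc e)
... | inj₂ e = inj₂ (cong suc e)

conj-costair-beyond : ∀ m → conj (costair m) (suc ⌈ m /2⌉) ≡ 0
conj-costair-beyond m = trans (conj-costair m (suc ⌈ m /2⌉) (s≤s z≤n)) (m≤n⇒m∸n≡0 (≤-double-⌈/2⌉ m))

costair-ends-11 : ∀ m → Σ (List ℕ) λ pre → costair (2+ m) ≡ pre ++ 1 ∷ 1 ∷ []
costair-ends-11 0       = [] , refl
costair-ends-11 (suc m) with costair-ends-11 m
... | pre , e = ⌈ 3 + m /2⌉ ∷ pre , cong (⌈ 3 + m /2⌉ ∷_) e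

-- The forbidden gaps (0 when
-- the two rows below also have the same length, 1 when they do not) put
-- hook 3 in the last column of the second row, respectively the cell above it.
extend-costair : ∀ x m → Linked _≥_ (x ∷ costair m) → 1 ≤ x → Is3Core (x ∷ costair m) → Shape3 (x ∷ costair m)
extend-costair x 0 _ 1≤x core = extend-empty x 1≤x core
extend-costair x 1 ord 1≤x core = extend-stair x 1 ord 1≤x core
extend-costair x (2+ m) ord _ core with gap (head ord) | ⌈suc/2⌉-step m
... | 0 , refl | inj₁ e = ⊥-elim (no-hook-3 ord core (suc ⌈ m /2⌉) (s≤s z≤n) ≤-refl
      (cong (_+ 1) (cong₂ _+_ (n∸n≡0 ⌈ m /2⌉)
        (trans (conj-cons-≤ {suc ⌈ m /2⌉} (costair (suc m)) ≤-refl)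
               (cong suc (trans (conj-cons-≤ {⌈ suc m /2⌉} (costair m) (≤-reflexive (sym e)))
                                (cong suc (conj-costair-beyond m))))))))
... | 0 , refl | inj₂ e = subst (λ a → Shape3 (suc a ∷ costair (2+ m))) e (costair-shape (3 + m))
... | 1 , refl | inj₁ e = subst (λ a → Shape3 (suc a ∷ costair (2+ m))) e (costair-shape (3 + m))
... | 1 , refl | inj₂ e = ⊥-elim (no-hook-3 ord core (suc ⌈ m /2⌉) (s≤s z≤n) (n≤1+n _)
      (cong₂ (λ a l → a + l + 1) (m+n∸n≡m 1 (suc ⌈ m /2⌉))
        (trans (conj-cons-≤ {suc ⌈ m /2⌉} (costair (suc m)) ≤-refl)
               (cong suc (conj-beyond (costair m) (costair-decreasing (suc m)) (s≤s (≤-reflexive e)))))))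
... | 2 , refl | _ = hybrid-shape (proj₁ (costair-ends-11 m)) (proj₂ (costair-ends-11 m))
... | suc (2+ d) , refl | _ = ⊥-elim (wide-gap ord core)

-- A 3-core with a hybrid (y+2, y, …) below its first row: gaps 0 and 1 put hook
-- 3 in column y+1, respectively y+2, so only a further step of 2 remains.
extend-hybrid : ∀ x y r pre → y ∷ r ≡ pre ++ 1 ∷ 1 ∷ [] → Linked _≥_ (x ∷ 2+ y ∷ y ∷ r) →
  Is3Core (x ∷ 2+ y ∷ y ∷ r) → Shape3 (x ∷ 2+ y ∷ y ∷ r)
extend-hybrid x y r pre e ord core with gap (head ord)
... | 0 , refl = ⊥-elim (no-hook-3 ord core (suc y) (s≤s z≤n) (n≤1+n _)
      (cong₂ (λ a l → a + l + 1) (m+n∸n≡m 1 y)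
        (trans (conj-cons-≤ {2+ y} {suc y} (y ∷ r) (n≤1+n _)) (cong suc (conj-beyond r (tail (tail ord)) ≤-refl)))))
... | 1 , refl = ⊥-elim (no-hook-3 ord core (2+ y) (s≤s z≤n) (n≤1+n _)
      (cong₂ (λ a l → a + l + 1) (m+n∸n≡m 1 (suc y))
        (trans (conj-cons-≤ {2+ y} {2+ y} (y ∷ r) ≤-refl) (cong suc (conj-beyond r (tail (tail ord)) (n≤1+n _))))))
... | 2 , refl = hybrid-shape (2+ y ∷ pre) (cong (2+ y ∷_) e)
... | suc (2+ d) , refl = ⊥-elim (wide-gap ord core)

extend : ∀ x rest → Shape3 rest → Linked _≥_ (x ∷ rest) → 1 ≤ x → Is3Core (x ∷ rest) → Shape3 (x ∷ rest)
extend x _ (stair-shape m)   = extend-stair x m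
extend x _ (costair-shape m) = extend-costair x m
extend x _ (hybrid-shape {y} {rest} pre e) ord _ = extend-hybrid x y rest pre e ord

classify : ∀ μ → Linked _≥_ μ → All (1 ≤_) μ → Is3Core μ → Shape3 μ
classify []       _   _           _    = stair-shape 0
classify (x ∷ xs) ord (1≤x ∷ pos) core =
  extend x xs (classify xs (tail ord) pos (core-tail ord core)) ord 1≤x core

corner-hook : ∀ {y rest} → All (1 ≤_) (y ∷ rest) →
  (2+ y ∸ 1) + conj (y ∷ rest) 1 + 1 ≡ 2+ (y + length (y ∷ rest))
corner-hook {y} {rest} pos = trans (cong (λ c → suc y + c + 1) (conj-one _ pos)) (regroup y (length (y ∷ rest)))
  where
  regroup : ∀ a b → suc a + b + 1 ≡ 2+ (a + b)
  regroup = solve-∀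

hybrid-hooks : ∀ {y rest pre} → y ∷ rest ≡ pre ++ 1 ∷ 1 ∷ [] → Linked _≥_ (2+ y ∷ y ∷ rest) →
  All (1 ≤_) (y ∷ rest) → ∀ h → IsHook (2+ y ∷ y ∷ rest) h →
  h ≡ 2+ (y + length (y ∷ rest)) ⊎ h + 3 ≤ 2+ (y + length (y ∷ rest))
hybrid-hooks {y} {rest} {pre} ends ord pos h hk with hook-split ord hk
... | inj₁ (1 , _ , _ , h≡) = inj₁ (trans h≡ (corner-hook pos))
... | inj₁ (2+ j , _ , _ , h≡) = inj₂ (begin
  h + 3                                      ≡⟨ cong (_+ 3) h≡ ⟩
  (y ∸ j) + conj (y ∷ rest) (2+ j) + 1 + 3   ≤⟨ +-monoˡ-≤ 3 (+-monoˡ-≤ 1 (+-mono-≤ (m∸n≤m y j) leg≤)) ⟩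
  y + length pre + 1 + 3                     ≡⟨ regroup y (length pre) ⟩
  2+ (y + (length pre + 2))                  ≡⟨ cong (λ l → 2+ (y + l)) length≡ ⟨
  2+ (y + length (y ∷ rest))                 ∎)
  where
  open ≤-Reasoning
  length≡ : length (y ∷ rest) ≡ length pre + 2
  length≡ = trans (cong length ends) (length-++ pre)
  -- only the rows of pre reach column j + 2
  leg≤ : conj (y ∷ rest) (2+ j) ≤ length pre
  leg≤ = begin
    conj (y ∷ rest) (2+ j)                          ≡⟨ cong (λ μ → conj μ (2+ j)) ends ⟩
    conj (pre ++ 1 ∷ 1 ∷ []) (2+ j)                 ≡⟨ conj-++ pre (1 ∷ 1 ∷ []) (2+ j) ⟩
    conj pre (2+ j) + conj (1 ∷ 1 ∷ []) (2+ j)      ≡⟨ cong (conj pre (2+ j) +_) (trans (conj-cons-> {1} {2+ j} (1 ∷ []) (s≤s (s≤s z≤n))) (conj-cons-> {1} {2+ j} [] (s≤s (s≤s z≤n)))) ⟩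
    conj pre (2+ j) + 0                             ≤⟨ +-monoˡ-≤ 0 (conj-≤-length pre (2+ j)) ⟩
    length pre + 0                                  ≡⟨ +-identityʳ _ ⟩
    length pre                                      ∎
  regroup : ∀ a b → a + b + 1 + 3 ≡ 2+ (a + (b + 2))
  regroup = solve-∀
... | inj₂ hk′ = inj₂ (begin
  h + 3                          ≤⟨ +-monoˡ-≤ 3 (hook-≤ rest h (tail ord) hk′) ⟩
  y + length rest + 3            ≡⟨ regroup y (length rest) ⟩
  2+ (y + length (y ∷ rest))     ∎)
  where
  open ≤-Reasoning
  regroup : ∀ a b → a + b + 3 ≡ 2+ (a + suc b)
  regroup = solve-∀

-- Hence K or K + 1, whichever is not a multiple of 3, is missing from the
-- hookset of a hybrid although it lies below the largest hook.
hybrid-not-CC3 : ∀ {y rest pre} → y ∷ rest ≡ pre ++ 1 ∷ 1 ∷ [] → Linked _≥_ (2+ y ∷ y ∷ rest) →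
  All (1 ≤_) (2+ y ∷ y ∷ rest) → ¬ IsCC3 (2+ y ∷ y ∷ rest)
hybrid-not-CC3 ends ord (_ ∷ pos) (_ , inj₁ ())
hybrid-not-CC3 {y} {rest} ends ord (_ ∷ pos) (_ , inj₂ (H , (_ , max) , segment)) =
  [ missing K ≤-refl (n≤1+n K) , missing (suc K) (n≤1+n K) ≤-refl ]′ (¬3∣-one-of K)
  where
  K : ℕ
  K = y + length (y ∷ rest)
  K+1≤H : suc K ≤ H
  K+1≤H = ≤-trans (n≤1+n _) (max _ (hook-join ord (inj₁ (1 , s≤s z≤n , s≤s z≤n , sym (corner-hook pos)))))
  1≤K : 1 ≤ K
  1≤K = ≤-trans (s≤s z≤n) (m≤n+m _ y)
  missing : ∀ c → K ≤ c → c ≤ suc K → ¬ 3 ∣ c → ⊥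
  missing c K≤c c≤K+1 ¬3∣c
    with hybrid-hooks ends ord pos c (from (segment c) (≤-trans 1≤K K≤c , ≤-trans c≤K+1 K+1≤H , ¬3∣c))
  ... | inj₁ refl = 1+n≰n c≤K+1
  ... | inj₂ c+3≤ = 1+n≰n (≤-trans (≤-reflexive (+-comm 3 K)) (≤-trans (+-monoˡ-≤ 3 K≤c) c+3≤))

counted-shape : ∀ {μ} → Shape3 μ → Linked _≥_ μ → All (1 ≤_) μ → IsCC3 μ →
  Σ ℕ λ m → μ ≡ stair m ⊎ μ ≡ costair m
counted-shape (stair-shape m)         _   _   _  = m , inj₁ refl
counted-shape (costair-shape m)       _   _   _  = m , inj₂ refl
counted-shape (hybrid-shape _ ends)   ord pos cc = ⊥-elim (hybrid-not-CC3 ends ord pos cc)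

counted⇔ : ∀ n μ → (IsPartitionOf n μ × IsCC3 μ) ⇔ (Σ ℕ λ m → size m ≡ n × (μ ≡ stair m ⊎ μ ≡ costair m))
counted⇔ n μ = mk⇔ forward backward
  where
  forward : ∀ {n μ} → IsPartitionOf n μ × IsCC3 μ → Σ ℕ λ m → size m ≡ n × (μ ≡ stair m ⊎ μ ≡ costair m)
  forward {μ = μ} ((ord , pos , sum≡n) , cc) with counted-shape (classify μ ord pos (proj₁ cc)) ord pos cc
  ... | m , inj₁ refl = m , sum≡n , inj₁ refl
  ... | m , inj₂ refl = m , trans (sym (sum-costair m)) sum≡n , inj₂ refl
  backward : ∀ {n μ} → (Σ ℕ λ m → size m ≡ n × (μ ≡ stair m ⊎ μ ≡ costair m)) → IsPartitionOf n μ × IsCC3 μ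
  backward (m , refl , inj₁ refl) = stair-counted m
  backward (m , refl , inj₂ refl) = costair-counted m

family : ℕ → List (List ℕ)
family 0      = stair 0 ∷ []
family 1      = stair 1 ∷ []
family (2+ m) = stair (2+ m) ∷ costair (2+ m) ∷ []

-- For m ≥ 2 the first rows m and ⌈m/2⌉ of stair m and costair m differ.
family-unique : ∀ m → Unique (family m)
family-unique 0      = [] ∷ []
family-unique 1      = [] ∷ []
family-unique (2+ m) = (distinct ∷ []) ∷ [] ∷ []
  where
  distinct : stair (2+ m) ≢ costair (2+ m)
  distinct e = 1+n≰n (subst (_≤ suc m) (sym (∷-injectiveˡ e)) (s≤s (⌈n/2⌉≤n m)))

family-∈ : ∀ m μ → μ ∈ family m ⇔ (μ ≡ stair m ⊎ μ ≡ costair m)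
family-∈ m μ = mk⇔ (forward m) (backward m)
  where
  forward : ∀ m → μ ∈ family m → μ ≡ stair m ⊎ μ ≡ costair m
  forward 0      (here e)         = inj₁ e
  forward 1      (here e)         = inj₁ e
  forward (2+ m) (here e)         = inj₁ e
  forward (2+ m) (there (here e)) = inj₂ e
  backward : ∀ m → μ ≡ stair m ⊎ μ ≡ costair m → μ ∈ family m
  backward 0      (inj₁ e) = here e
  backward 0      (inj₂ e) = here e
  backward 1      (inj₁ e) = here e
  backward 1      (inj₂ e) = here e
  backward (2+ m) (inj₁ e) = here e
  backward (2+ m) (inj₂ e) = there (here e)

family-members : ∀ m μ → μ ∈ family m ⇔ (IsPartitionOf (size m) μ × IsCC3 μ)
family-members m μ =
  ⇔-trans (family-∈ m μ) (⇔-trans (mk⇔ (λ s → m , refl , s) same-size) (⇔-sym (counted⇔ (size m) μ)))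
  where
  same-size : (Σ ℕ λ k → size k ≡ size m × (μ ≡ stair k ⊎ μ ≡ costair k)) → μ ≡ stair m ⊎ μ ≡ costair m
  same-size (k , size≡ , s) = subst (λ i → μ ≡ stair i ⊎ μ ≡ costair i) (inc-injective size-increasing size≡) s

δ-refl : ∀ a → δ (a ≡ᵇ a) ≡ 1
δ-refl zero    = refl
δ-refl (suc a) = δ-refl a

δ-≢ : ∀ a b → a ≢ b → δ (a ≡ᵇ b) ≡ 0
δ-≢ zero    zero    a≢b = ⊥-elim (a≢b refl)
δ-≢ zero    (suc b) _   = refl
δ-≢ (suc a) zero    _   = refl
δ-≢ (suc a) (suc b) a≢b = δ-≢ a b (a≢b ∘ cong suc)

hits : ℕ → (ℕ → ℕ) → ℕ → ℕ
hits n g N = sum (applyUpTo (λ j → δ (g j ≡ᵇ n)) N)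

hits-none : ∀ {n} g N → (∀ j → g j ≢ n) → hits n g N ≡ 0
hits-none g zero    _    = refl
hits-none g (suc N) miss = cong₂ _+_ (δ-≢ _ _ (miss 0)) (hits-none (g ∘ suc) N (miss ∘ suc))

hits-one : ∀ {n} g N c → (∀ {a b} → g a ≡ g b → a ≡ b) → c < N → g c ≡ n → hits n g N ≡ 1
hits-one g (suc N) zero g-inj _ g0≡n =
  cong₂ _+_ (trans (cong (λ k → δ (g 0 ≡ᵇ k)) (sym g0≡n)) (δ-refl (g 0)))
            (hits-none (g ∘ suc) N (λ j gj≡n → 0≢1+n (g-inj (trans g0≡n (sym gj≡n)))))
hits-one g (suc N) (suc c) g-inj (s≤s c<N) gc≡n =
  cong₂ _+_ (δ-≢ _ _ (λ g0≡n → 0≢1+n (g-inj (trans g0≡n (sym gc≡n)))))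
            (hits-one (g ∘ suc) N c (suc-injective ∘ g-inj) c<N gc≡n)

sum-pairs : ∀ f h N → (∀ t → h t ≡ f (double t) + f (suc (double t))) →
  sum (applyUpTo h N) ≡ sum (applyUpTo f (double N))
sum-pairs f h zero    _     = refl
sum-pairs f h (suc N) split = begin
  h 0 + sum (applyUpTo (h ∘ suc) N)                          ≡⟨ cong₂ _+_ (split 0) (sum-pairs (f ∘ suc ∘ suc) (h ∘ suc) N (split ∘ suc)) ⟩
  f 0 + f 1 + sum (applyUpTo (f ∘ suc ∘ suc) (double N))     ≡⟨ +-assoc (f 0) (f 1) _ ⟩
  f 0 + (f 1 + sum (applyUpTo (f ∘ suc ∘ suc) (double N)))   ∎
  where open ≡-Reasoning

term : ℕ → ℕ → ℕ
term n k = if 2 ≤ᵇ k then δ (k * k ≡ᵇ n) + δ (k * k ∸ k ≡ᵇ n) else 0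

-- For k = t + 2 the summand tests n against size (2t+2) = k² - k and size (2t+3) = k².
term-sizes : ∀ n t → term n (2+ t) ≡ δ (size (2+ (double t)) ≡ᵇ n) + δ (size (suc (2+ (double t))) ≡ᵇ n)
term-sizes n t = trans (cong₂ (λ a b → δ (a ≡ᵇ n) + δ (b ≡ᵇ n)) square oblong)
                        (+-comm (δ (size (suc (2+ (double t))) ≡ᵇ n)) (δ (size (2+ (double t)) ≡ᵇ n)))
  where
  square : 2+ t * 2+ t ≡ size (suc (double (suc t)))
  square = sym (size-odd (suc t))
  oblong : 2+ t * 2+ t ∸ 2+ t ≡ size (double (suc t))
  oblong = trans (cong (_∸ 2+ t) (expand t)) (trans (m+n∸n≡m _ (2+ t)) (sym (size-even (suc t))))
    where
    expand : ∀ t → 2+ t * 2+ t ≡ suc t * 2+ t + 2+ t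
    expand = solve-∀

≤-double : ∀ n → n ≤ double n
≤-double zero    = z≤n
≤-double (suc n) = s≤s (≤-trans (≤-double n) (n≤1+n _))

rhsCoeff-hits : ∀ n → rhsCoeff n ≡ δ (n ≡ᵇ 0) + δ (n ≡ᵇ 1) + 2 * hits n (size ∘ suc ∘ suc) (double (n ∸ 1))
rhsCoeff-hits n =
  cong (λ s → δ (n ≡ᵇ 0) + δ (n ≡ᵇ 1) + 2 * s) (trans (cong sum (map-upTo (term n) (suc n))) (summands n))
  where
  -- the summands k = 0, 1 vanish; the others pair up as in term-sizes
  summands : ∀ n → sum (applyUpTo (term n) (suc n)) ≡ hits n (size ∘ suc ∘ suc) (double (n ∸ 1))
  summands 0       = refl
  summands 1       = refl
  summands (2+ n′) = sum-pairs (λ j → δ (size (2+ j) ≡ᵇ 2+ n′)) (term (2+ n′) ∘ suc ∘ suc) (suc n′) (term-sizes (2+ n′))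

-- For m ≥ 2, size m is hit exactly once, by j = m - 2.
rhsCoeff-size : ∀ m → rhsCoeff (size m) ≡ length (family m)
rhsCoeff-size 0      = refl
rhsCoeff-size 1      = refl
rhsCoeff-size (2+ c) = trans (rhsCoeff-hits n)
  (cong₂ (λ a b → a + 2 * b) (cong₂ _+_ (δ-≢ n 0 (>⇒≢ (≤-trans (s≤s z≤n) 2≤n))) (δ-≢ n 1 (>⇒≢ 2≤n)))
                             (hits-one (size ∘ suc ∘ suc) (double (n ∸ 1)) c size₂-injective c<bound refl))
  where
  n : ℕ
  n = size (2+ c)
  2+c≤n : 2+ c ≤ n
  2+c≤n = inc-≥-id size-increasing (2+ c)
  2≤n : 2 ≤ n
  2≤n = ≤-trans (s≤s (s≤s z≤n)) 2+c≤n
  c<bound : c < double (n ∸ 1)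
  c<bound = ≤-trans (∸-monoˡ-≤ 1 2+c≤n) (≤-double (n ∸ 1))
  size₂-injective : ∀ {a b} → size (2+ a) ≡ size (2+ b) → a ≡ b
  size₂-injective = suc-injective ∘ suc-injective ∘ inc-injective size-increasing

rhsCoeff-nonsize : ∀ n → (∀ m → size m ≢ n) → rhsCoeff n ≡ 0
rhsCoeff-nonsize n not-size = trans (rhsCoeff-hits n)
  (cong₂ (λ a b → a + 2 * b) (cong₂ _+_ (δ-≢ n 0 (not-size 0 ∘ sym)) (δ-≢ n 1 (not-size 1 ∘ sym)))
                             (hits-none (size ∘ suc ∘ suc) (double (n ∸ 1)) (not-size ∘ suc ∘ suc)))

theorem6 : (n : ℕ) → Σ (List (List ℕ)) λ L →
    Unique L × (∀ μ → μ ∈ L ⇔ (IsPartitionOf n μ × IsCC3 μ)) × length L ≡ rhsCoeff n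
theorem6 n with inc-preimage? size-increasing n
... | inj₁ (m , refl) = family m , family-unique m , family-members m , sym (rhsCoeff-size m)
... | inj₂ not-size   = [] , [] , (λ μ → mk⇔ (λ ()) (uncounted μ)) , sym (rhsCoeff-nonsize n not-size)
  where
  uncounted : ∀ μ → IsPartitionOf n μ × IsCC3 μ → μ ∈ []
  uncounted μ counted with to (counted⇔ n μ) counted
  ... | m , size≡n , _ = ⊥-elim (not-size m size≡n)
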